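{- Let $q$ be a prime power and $s,t,k$ integers with $0\le s\le t\le k$. If there exists a linear AOA$(s,t,k,q)$, then there exists a linear AOA$(k-t,k-s,k,q)$.
   Context: An orthogonal array OA$(t,k,v)$ is a $v^t\times k$ array with entries from a set $X$ of size $v$ such that the restriction to any $t$ columns contains every $t$-tuple of $X^t$ exactly once. An AOA$(s,t,k,v)$ is a $v^t\times (k+1)$ array $A$ such that: (1) the first $k$ columns form an OA$(t,k,v)$ on a set $X$ with $|X|=v$; (2) the last column has symbols from a set $Y$ with $|Y|=v^{t-s}$; (3) any $s$ of the first $k$ columns together with the last column contain every $(s+1)$-tuple of $X^s\times Y$ exactly once. A linear AOA$(s,t,k,q)$ is an AOA$(s,t,k,q)$ with $X=\mathbb{F}_q$, $Y=\mathbb{F}_q^{t-s}$, whose set of rows, each regarded as a vector of $\mathbb{F}_q^{k+t-s}$ (first $k$ entries followed by the $t-s$ coordinates of the last entry), is a $t$-dimensional $\mathbb{F}_q$-subspace. -}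

module Defs where

open import Data.Nat using (ℕ; zero; suc; _^_; _≤_; _∸_) renaming (_+_ to _+ℕ_)
open import Data.Fin using (Fin; zero; suc; splitAt)
open import Data.Product using (Σ; _×_; ∃!)
open import Data.Sum using ([_,_])
open import Relation.Nullary using (¬_)
open import Relation.Binary.PropositionalEquality using (_≡_)
open import Algebra.Core using (Op₁; Op₂)
open import Algebra.Structures using (IsCommutativeRing)
open import Function.Bundles using (_↔_)
open import Function.Definitions using (Injective)
open import Data.Nat.Primality using (Prime)

IsPrimePower : ℕ → Set
IsPrimePower q = Σ ℕ λ p → Σ ℕ λ m → Prime p × (1 ≤ m) × (q ≡ p ^ m)

record FiniteField (q : ℕ) : Set₁ where
  infixl 7 _*_
  infixl 6 _+_
  field
    Carrier           : Set
    _+_ _*_           : Op₂ Carrier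
    -_                : Op₁ Carrier
    0# 1#             : Carrier
    isCommutativeRing : IsCommutativeRing _≡_ _+_ _*_ -_ 0# 1#
    0≢1               : ¬ (0# ≡ 1#)
    inverse           : ∀ x → ¬ (x ≡ 0#) → Σ Carrier λ y → x * y ≡ 1#
    enum              : Carrier ↔ Fin q

module _ {q : ℕ} (F : FiniteField q) where
  open FiniteField F

  sumF : ∀ n → (Fin n → Carrier) → Carrier
  sumF zero    f = 0#
  sumF (suc n) f = f zero + sumF n (λ i → f (suc i))

  lincomb : ∀ {n m} → (Fin n → Carrier) → (Fin n → Fin m → Carrier) → Fin m → Carrier
  lincomb {n} c b i = sumF n (λ j → c j * b j i)

  -- A linear AOA(s,t,k,q): rows indexed by Fin (q^t); the first k entries of a
  -- row are  cols r , the last column entry is  lastCol r ∈ F^(t-s).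
  record LinearAOA (s t k : ℕ) : Set where
    field
      cols    : Fin (q ^ t) → Fin k → Carrier
      lastCol : Fin (q ^ t) → Fin (t ∸ s) → Carrier
      oa  : (c : Fin t → Fin k) → Injective _≡_ _≡_ c → (x : Fin t → Carrier) →
            ∃! _≡_ λ r → ∀ j → cols r (c j) ≡ x j
      aoa : (c : Fin s → Fin k) → Injective _≡_ _≡_ c →
            (x : Fin s → Carrier) (y : Fin (t ∸ s) → Carrier) →
            ∃! _≡_ λ r → (∀ j → cols r (c j) ≡ x j) × (∀ j → lastCol r j ≡ y j)

    row : Fin (q ^ t) → Fin (k +ℕ (t ∸ s)) → Carrier
    row r i = [ cols r , lastCol r ] (splitAt k i)

    field
      -- linearity: the set of rows is a t-dimensional subspace,
      -- i.e. it is exactly the span of t linearly independent vectors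
      basis       : Fin t → Fin (k +ℕ (t ∸ s)) → Carrier
      independent : (a : Fin t → Carrier) → (∀ i → lincomb a basis i ≡ 0#) → ∀ j → a j ≡ 0#
      rowsInSpan  : ∀ r → Σ (Fin t → Carrier) λ a → ∀ i → row r i ≡ lincomb a basis i
      spanInRows  : (a : Fin t → Carrier) → Σ (Fin (q ^ t)) λ r → ∀ i → row r i ≡ lincomb a basis i

{-# OPTIONS --safe #-}
-- The rows of a linear AOA(s,t,k,q) form a t-dimensional code C in F^(k+u), u = t - s, in which
-- any t of the first k coordinates, and any s of them together with the last u, are information
-- sets. If T is an information set of C and S its complement, then S is one of the dual code:
-- the codewords that are δ_j on T span C, so orthogonality to them fixes a dual vector on T
-- from its values on S, and any values on S extend. The complement of any k - s of the first k
-- coordinates is s of them plus the last u, and that of any k - t of them plus the last u is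
-- t of the first k; so C^⊥ (of dimension k - s) is a linear AOA(k-t, k-s, k, q).
module Submission where

open import Defs
open import Data.Nat using (ℕ; zero; suc; _≤_; _∸_; _^_) renaming (_+_ to _+ℕ_)
open import Data.Nat.Properties using (≤-trans; m∸n≤m; m∸n+n≡m; +-∸-assoc; m+n∸m≡n)
open import Data.Fin using (Fin; zero; suc; _↑ˡ_; _↑ʳ_; splitAt; join; punchIn; punchOut;
  inject≤; combine; finToFun; funToFin)
open import Data.Fin.Properties using (splitAt-↑ˡ; splitAt-↑ʳ; splitAt-join; join-splitAt;
  punchIn-punchOut; inject≤-injective; finToFun-funToFin; funToFin-finToFin; 0≢1+n; suc-injective)
open import Data.Fin.Permutation using (Permutation; permutation; _⟨$⟩ʳ_; _⟨$⟩ˡ_; inverseˡ; inverseʳ;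
  insert; insert-punchIn)
import Data.Fin.Permutation as Permutation
open import Data.Product using (Σ; _×_; _,_; proj₁; proj₂; ∃!)
open import Data.Sum using (_⊎_; inj₁; inj₂; [_,_]; map₁; map₂; swap)
open import Data.Sum.Properties using (inj₂-injective; [,]-∘)
open import Data.Vec.Functional using (Vector; _++_)
open import Data.Vec.Functional.Properties using (lookup-++ˡ; lookup-++ʳ)
open import Function using (_∘_; _⇔_; mk⇔; Equivalence)
open import Function.Bundles using (Inverse)
open import Function.Definitions using (Injective)
open import Relation.Binary.PropositionalEquality hiding ([_])
open import Algebra.Bundles using (CommutativeRing)
open import Algebra.Structures using (IsCommutativeRing)

∃!-map : ∀ {A : Set} {P Q : A → Set} → (∀ {r} → P r → Q r) → (∀ {r} → Q r → P r) →
  ∃! _≡_ P → ∃! _≡_ Q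
∃!-map to from (r , p , unique) = r , to p , unique ∘ from

[o∸m]∸[o∸n]≡n∸m : ∀ {m n o} → m ≤ n → n ≤ o → (o ∸ m) ∸ (o ∸ n) ≡ n ∸ m
[o∸m]∸[o∸n]≡n∸m {m} {n} {o} m≤n n≤o = begin
  (o ∸ m) ∸ (o ∸ n)                ≡⟨ cong (λ o′ → (o′ ∸ m) ∸ (o ∸ n)) (sym (m∸n+n≡m n≤o)) ⟩
  ((o ∸ n) +ℕ n ∸ m) ∸ (o ∸ n)     ≡⟨ cong (_∸ (o ∸ n)) (+-∸-assoc (o ∸ n) m≤n) ⟩
  ((o ∸ n) +ℕ (n ∸ m)) ∸ (o ∸ n)   ≡⟨ m+n∸m≡n (o ∸ n) (n ∸ m) ⟩
  n ∸ m                            ∎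
  where open ≡-Reasoning

↑ˡ-++-↑ʳ : ∀ m {n} {A : Set} (f : Vector A (m +ℕ n)) i → ((f ∘ (_↑ˡ n)) ++ (f ∘ (m ↑ʳ_))) i ≡ f i
↑ˡ-++-↑ʳ m {n} f i = trans (sym ([,]-∘ f (splitAt m i))) (cong f (join-splitAt m n i))

funToFin-cong : ∀ {m n} {f g : Fin m → Fin n} → f ≗ g → funToFin f ≡ funToFin g
funToFin-cong {zero}  f≗g = refl
funToFin-cong {suc m} f≗g = cong₂ combine (f≗g zero) (funToFin-cong (f≗g ∘ suc))

record Partition {a b n : ℕ} (S : Fin a → Fin n) (T : Fin b → Fin n) : Set where
  field
    part   : Fin n → Fin a ⊎ Fin b
    part-S : ∀ l → part (S l) ≡ inj₁ l
    part-T : ∀ j → part (T j) ≡ inj₂ j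
    cover  : ∀ i → [ S , T ] (part i) ≡ i

  part-[S,T] : ∀ w → part ([ S , T ] w) ≡ w
  part-[S,T] (inj₁ l) = part-S l
  part-[S,T] (inj₂ j) = part-T j

  T-injective : Injective _≡_ _≡_ T
  T-injective {x} {y} Tx≡Ty = inj₂-injective (trans (sym (part-T x)) (trans (cong part Tx≡Ty) (part-T y)))

  agree : ∀ {A : Set} {f g : Fin n → A} → f ∘ S ≗ g ∘ S → f ∘ T ≗ g ∘ T → f ≗ g
  agree {f = f} {g} onS onT i = subst (λ i → f i ≡ g i) (cover i) (on (part i))
    where
    on : ∀ w → f ([ S , T ] w) ≡ g ([ S , T ] w)
    on (inj₁ l) = onS l
    on (inj₂ j) = onT j

  toPermutation : Permutation (a +ℕ b) n
  toPermutation = permutation (S ++ T) (join a b ∘ part)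
    (λ i → trans (cong [ S , T ] (splitAt-join a b (part i))) (cover i))
    (λ i → trans (cong (join a b) (part-[S,T] (splitAt a i))) (join-splitAt a b i))

swapPartition : ∀ {a b n} {S : Fin a → Fin n} {T : Fin b → Fin n} → Partition S T → Partition T S
swapPartition {S = S} {T} P = record
  { part   = swap ∘ part
  ; part-S = cong swap ∘ part-T
  ; part-T = cong swap ∘ part-S
  ; cover  = λ i → trans (swapped (part i)) (cover i)
  }
  where
  open Partition P
  swapped : ∀ w → [ T , S ] (swap w) ≡ [ S , T ] w
  swapped (inj₁ l) = refl
  swapped (inj₂ j) = refl

withLast : ∀ {b k} u → (Fin b → Fin k) → Fin (b +ℕ u) → Fin (k +ℕ u)
withLast {b} {k} u c = join k u ∘ map₁ c ∘ splitAt b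

withLast-↑ˡ : ∀ {b k} u (c : Fin b → Fin k) j → withLast u c (j ↑ˡ u) ≡ c j ↑ˡ u
withLast-↑ˡ {b} {k} u c j = cong (join k u ∘ map₁ c) (splitAt-↑ˡ b j u)

withLast-↑ʳ : ∀ {b k} u (c : Fin b → Fin k) j → withLast u c (b ↑ʳ j) ≡ k ↑ʳ j
withLast-↑ʳ {b} {k} u c j = cong (join k u ∘ map₁ c) (splitAt-↑ʳ b u j)

withLast-agree : ∀ {s k u} {A : Set} (c : Fin s → Fin k) (f : Vector A (k +ℕ u))
  (x : Vector A s) (y : Vector A u) →
  (∀ i → f (withLast u c i) ≡ (x ++ y) i) ⇔
  ((∀ j → f (c j ↑ˡ u) ≡ x j) × (∀ j → f (k ↑ʳ j) ≡ y j))
withLast-agree {s} {k} {u} c f x y = mk⇔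
  (λ h → (λ j → subst Agree (splitAt-↑ˡ s j u) (h (j ↑ˡ u))) ,
         (λ j → subst Agree (splitAt-↑ʳ s u j) (h (s ↑ʳ j))))
  (λ (onc , onLast) i → onSum onc onLast (splitAt s i))
  where
  Agree : Fin s ⊎ Fin u → Set _
  Agree w = f (join k u (map₁ c w)) ≡ [ x , y ] w
  onSum : (∀ j → f (c j ↑ˡ u) ≡ x j) → (∀ j → f (k ↑ʳ j) ≡ y j) → ∀ w → Agree w
  onSum onc onLast (inj₁ j) = onc j
  onSum onc onLast (inj₂ j) = onLast j

extendPartition : ∀ {a b k} {S : Fin a → Fin k} {T : Fin b → Fin k} u →
  Partition S T → Partition (λ l → S l ↑ˡ u) (withLast u T)
extendPartition {a} {b} {k} {S} {T} u P = record
  { part = part′ ; part-S = part′-S ; part-T = part′-T ; cover = cover′ }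
  where
  open Partition P
  part′ : Fin (k +ℕ u) → Fin a ⊎ Fin (b +ℕ u)
  part′ = [ map₂ (_↑ˡ u) ∘ part , inj₂ ∘ (b ↑ʳ_) ] ∘ splitAt k

  part′-S : ∀ l → part′ (S l ↑ˡ u) ≡ inj₁ l
  part′-S l rewrite splitAt-↑ˡ k (S l) u | part-S l = refl

  part′-T : ∀ i → part′ (withLast u T i) ≡ inj₂ i
  part′-T i = trans (onJoin (splitAt b i)) (cong inj₂ (join-splitAt b u i))
    where
    onJoin : ∀ w → part′ (join k u (map₁ T w)) ≡ inj₂ (join b u w)
    onJoin (inj₁ j) rewrite splitAt-↑ˡ k (T j) u | part-T j = refl
    onJoin (inj₂ j) rewrite splitAt-↑ʳ k u j = refl

  cover′ : ∀ i → [ (λ l → S l ↑ˡ u) , withLast u T ] (part′ i) ≡ i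
  cover′ i = trans (onSplit (splitAt k i)) (join-splitAt k u i)
    where
    lifted : ∀ w → [ (λ l → S l ↑ˡ u) , withLast u T ] (map₂ (_↑ˡ u) w) ≡ [ S , T ] w ↑ˡ u
    lifted (inj₁ l) = refl
    lifted (inj₂ j) = withLast-↑ˡ u T j
    onSplit : ∀ w → [ (λ l → S l ↑ˡ u) , withLast u T ] ([ map₂ (_↑ˡ u) ∘ part , inj₂ ∘ (b ↑ʳ_) ] w)
                    ≡ join k u w
    onSplit (inj₁ x) = trans (lifted (part x)) (cong (_↑ˡ u) (cover x))
    onSplit (inj₂ j) = withLast-↑ʳ u T j

injection-extends-to-permutation : ∀ {a b} (c : Fin a → Fin (a +ℕ b)) → Injective _≡_ _≡_ c →
  Σ (Permutation (a +ℕ b) (a +ℕ b)) λ π → ∀ l → π ⟨$⟩ʳ (l ↑ˡ b) ≡ c l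
injection-extends-to-permutation {zero}  c _   = Permutation.id , λ ()
injection-extends-to-permutation {suc a} {b} c inj = insert zero (c zero) π , extends
  where
  avoids : ∀ l → c zero ≢ c (suc l)
  avoids l c₀≡cₗ = 0≢1+n (inj c₀≡cₗ)
  c′ : Fin a → Fin (a +ℕ b)
  c′ l = punchOut (avoids l)
  c′-injective : Injective _≡_ _≡_ c′
  c′-injective {x} {y} eq = suc-injective (inj (begin
    c (suc x)                     ≡⟨ sym (punchIn-punchOut (avoids x)) ⟩
    punchIn (c zero) (c′ x)       ≡⟨ cong (punchIn (c zero)) eq ⟩
    punchIn (c zero) (c′ y)       ≡⟨ punchIn-punchOut (avoids y) ⟩
    c (suc y)                     ∎))
    where open ≡-Reasoning
  π = proj₁ (injection-extends-to-permutation c′ c′-injective)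
  π-extends : ∀ l → π ⟨$⟩ʳ (l ↑ˡ b) ≡ c′ l
  π-extends = proj₂ (injection-extends-to-permutation c′ c′-injective)
  extends : ∀ l → insert zero (c zero) π ⟨$⟩ʳ (l ↑ˡ b) ≡ c l
  extends zero    = refl
  extends (suc l) = trans (insert-punchIn zero (c zero) π (l ↑ˡ b))
    (trans (cong (punchIn (c zero)) (π-extends l)) (punchIn-punchOut (avoids l)))

complementPartition : ∀ {a b n} (c : Fin a → Fin n) → Injective _≡_ _≡_ c → a +ℕ b ≡ n →
  Σ (Fin b → Fin n) (Partition c)
complementPartition {a} {b} c inj refl = T , record
  { part = part ; part-S = part-S ; part-T = part-T ; cover = cover }
  where
  π = proj₁ (injection-extends-to-permutation c inj)
  extends = proj₂ (injection-extends-to-permutation c inj)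
  T : Fin b → Fin (a +ℕ b)
  T j = π ⟨$⟩ʳ (a ↑ʳ j)
  part : Fin (a +ℕ b) → Fin a ⊎ Fin b
  part i = splitAt a (π ⟨$⟩ˡ i)
  part-S : ∀ l → part (c l) ≡ inj₁ l
  part-S l = trans (cong part (sym (extends l))) (trans (cong (splitAt a) (inverseˡ π)) (splitAt-↑ˡ a l b))
  part-T : ∀ j → part (T j) ≡ inj₂ j
  part-T j = trans (cong (splitAt a) (inverseˡ π)) (splitAt-↑ʳ a b j)
  viaπ : ∀ w → [ c , T ] w ≡ π ⟨$⟩ʳ join a b w
  viaπ (inj₁ l) = sym (extends l)
  viaπ (inj₂ j) = refl
  cover : ∀ i → [ c , T ] (part i) ≡ i
  cover i = trans (viaπ (part i)) (trans (cong (π ⟨$⟩ʳ_) (join-splitAt a b _)) (inverseʳ π))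

module _ {q : ℕ} (F : FiniteField q) where
  open FiniteField F
  open IsCommutativeRing isCommutativeRing
    using (*-comm; *-assoc; *-identityʳ; zeroʳ; +-identityˡ; +-identityʳ; +-assoc; -‿inverseʳ)

  commutativeRing : CommutativeRing _ _
  commutativeRing = record
    { Carrier = Carrier ; _≈_ = _≡_ ; _+_ = _+_ ; _*_ = _*_ ; -_ = -_ ; 0# = 0# ; 1# = 1#
    ; isCommutativeRing = isCommutativeRing }

  open import Algebra.Properties.Semiring.Sum (CommutativeRing.semiring commutativeRing)
    using (sum; sum-syntax; sum-cong-≗; sum-replicate-zero; ∑-comm; ∑-permute; *-distribˡ-sum; *-distribʳ-sum)
  open import Algebra.Properties.Group (CommutativeRing.+-group commutativeRing) using (inverseʳ-unique)
  open ≡-Reasoning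

  sumF≡sum : ∀ n (f : Vector Carrier n) → sumF F n f ≡ sum f
  sumF≡sum zero    f = refl
  sumF≡sum (suc n) f = cong (f zero +_) (sumF≡sum n (f ∘ suc))

  lincomb≡∑ : ∀ {m n} (a : Vector Carrier m) (B : Fin m → Vector Carrier n) i →
    lincomb F a B i ≡ ∑[ j < m ] (a j * B j i)
  lincomb≡∑ {m} a B i = sumF≡sum m _

  ∑-0 : ∀ {n} {f : Vector Carrier n} → (∀ i → f i ≡ 0#) → sum f ≡ 0#
  ∑-0 {n} f≗0 = trans (sum-cong-≗ f≗0) (sum-replicate-zero n)

  ∑-splitAt : ∀ m {n} (f : Vector Carrier (m +ℕ n)) →
    sum f ≡ ∑[ l < m ] f (l ↑ˡ n) + ∑[ j < n ] f (m ↑ʳ j)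
  ∑-splitAt zero    f = sym (+-identityˡ _)
  ∑-splitAt (suc m) f = trans (cong (f zero +_) (∑-splitAt m (f ∘ suc))) (sym (+-assoc _ _ _))

  ∑-partition : ∀ {a b n} {S : Fin a → Fin n} {T : Fin b → Fin n} → Partition S T →
    ∀ (f : Vector Carrier n) → sum f ≡ ∑[ l < a ] f (S l) + ∑[ j < b ] f (T j)
  ∑-partition {a} {b} {S = S} {T} P f = begin
    sum f                                                        ≡⟨ ∑-permute f (Partition.toPermutation P) ⟩
    sum (f ∘ (S ++ T))                                           ≡⟨ ∑-splitAt a (f ∘ (S ++ T)) ⟩
    ∑[ l < a ] f ((S ++ T) (l ↑ˡ b)) + ∑[ j < b ] f ((S ++ T) (a ↑ʳ j))
      ≡⟨ cong₂ _+_ (sum-cong-≗ (cong f ∘ lookup-++ˡ S T)) (sum-cong-≗ (cong f ∘ lookup-++ʳ S T)) ⟩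
    ∑[ l < a ] f (S l) + ∑[ j < b ] f (T j)                      ∎

  δ : ∀ {n} → Fin n → Fin n → Carrier
  δ zero    zero    = 1#
  δ zero    (suc _) = 0#
  δ (suc _) zero    = 0#
  δ (suc i) (suc j) = δ i j

  δ-comm : ∀ {n} (i j : Fin n) → δ i j ≡ δ j i
  δ-comm zero    zero    = refl
  δ-comm zero    (suc _) = refl
  δ-comm (suc _) zero    = refl
  δ-comm (suc i) (suc j) = δ-comm i j

  ∑-*-δ : ∀ {n} (f : Vector Carrier n) j → ∑[ i < n ] (f i * δ i j) ≡ f j
  ∑-*-δ f zero = begin
    f zero * 1# + ∑[ i < _ ] (f (suc i) * 0#) ≡⟨ cong₂ _+_ (*-identityʳ _) (∑-0 (λ i → zeroʳ (f (suc i)))) ⟩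
    f zero + 0#                              ≡⟨ +-identityʳ _ ⟩
    f zero                                   ∎
  ∑-*-δ f (suc j) = trans (cong₂ _+_ (zeroʳ _) (∑-*-δ (f ∘ suc) j)) (+-identityˡ _)

  infix 7 _·_
  _·_ : ∀ {n} → Vector Carrier n → Vector Carrier n → Carrier
  _·_ {n} v w = ∑[ i < n ] (v i * w i)

  ·-comm : ∀ {n} (v w : Vector Carrier n) → v · w ≡ w · v
  ·-comm v w = sum-cong-≗ (λ i → *-comm (v i) (w i))

  ∑∑-assoc : ∀ {m n} (a : Vector Carrier m) (B : Fin m → Vector Carrier n) (w : Vector Carrier n) →
    ∑[ i < n ] (∑[ j < m ] (a j * B j i) * w i) ≡ ∑[ j < m ] (a j * ∑[ i < n ] (B j i * w i))
  ∑∑-assoc {m} {n} a B w = begin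
    ∑[ i < n ] (∑[ j < m ] (a j * B j i) * w i)
      ≡⟨ sum-cong-≗ (λ i → *-distribʳ-sum (w i) (λ j → a j * B j i)) ⟩
    ∑[ i < n ] ∑[ j < m ] (a j * B j i * w i)
      ≡⟨ ∑-comm (λ i j → a j * B j i * w i) ⟩
    ∑[ j < m ] ∑[ i < n ] (a j * B j i * w i)
      ≡⟨ sum-cong-≗ (λ j → trans (sum-cong-≗ (λ i → *-assoc (a j) (B j i) (w i)))
                                 (sym (*-distribˡ-sum (a j) (λ i → B j i * w i)))) ⟩
    ∑[ j < m ] (a j * ∑[ i < n ] (B j i * w i))
      ∎

  lincomb-· : ∀ {m n} (a : Vector Carrier m) (vs : Fin m → Vector Carrier n) (w : Vector Carrier n) →
    lincomb F a vs · w ≡ ∑[ j < m ] (a j * (vs j · w))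
  lincomb-· a vs w = trans (sum-cong-≗ (λ i → cong (_* w i) (lincomb≡∑ a vs i))) (∑∑-assoc a vs w)

  LinearlyClosed : ∀ {n} → (Vector Carrier n → Set) → Set
  LinearlyClosed {n} P = ∀ {m} (a : Vector Carrier m) (vs : Fin m → Vector Carrier n) →
    (∀ j → P (vs j)) → P (lincomb F a vs)

  Span : ∀ {m n} → (Fin m → Vector Carrier n) → Vector Carrier n → Set
  Span {m} B v = Σ (Vector Carrier m) λ a → ∀ i → v i ≡ lincomb F a B i

  span-closed : ∀ {m n} (B : Fin m → Vector Carrier n) → LinearlyClosed (Span B)
  span-closed {m} B {k} a vs vs∈ = β , λ i → begin
    lincomb F a vs i                                 ≡⟨ lincomb≡∑ a vs i ⟩
    ∑[ j < k ] (a j * vs j i)                        ≡⟨ sum-cong-≗ (λ j → cong (a j *_)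
                                                         (trans (proj₂ (vs∈ j) i) (lincomb≡∑ (α j) B i))) ⟩
    ∑[ j < k ] (a j * ∑[ l < m ] (α j l * B l i))    ≡⟨ sym (∑∑-assoc a α (λ l → B l i)) ⟩
    ∑[ l < m ] (β l * B l i)                         ≡⟨ sym (lincomb≡∑ β B i) ⟩
    lincomb F β B i                                  ∎
    where
    α : Fin k → Vector Carrier m
    α j = proj₁ (vs∈ j)
    β : Vector Carrier m
    β l = ∑[ j < k ] (a j * α j l)

  Dual : ∀ {n} → (Vector Carrier n → Set) → Vector Carrier n → Set
  Dual P d = ∀ v → P v → v · d ≡ 0#

  dual-closed : ∀ {n} {P : Vector Carrier n → Set} → LinearlyClosed (Dual P)
  dual-closed {m = m} a ds ds⊥ v v∈ = begin
    v · lincomb F a ds               ≡⟨ ·-comm v _ ⟩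
    lincomb F a ds · v               ≡⟨ lincomb-· a ds v ⟩
    ∑[ j < m ] (a j * (ds j · v))    ≡⟨ ∑-0 (λ j → trans (cong (a j *_) (trans (·-comm (ds j) v) (ds⊥ j v v∈)))
                                                         (zeroʳ (a j))) ⟩
    0#                               ∎

  record InformationSet {m n} (P : Vector Carrier n → Set) (S : Fin m → Fin n) : Set where
    field
      extend   : Vector Carrier m → Vector Carrier n
      extend∈  : ∀ x → P (extend x)
      extend-S : ∀ x l → extend x (S l) ≡ x l
      unique   : ∀ {v w} → P v → P w → v ∘ S ≗ w ∘ S → v ≗ w

  informationSet-fromRows : ∀ {N m n} {P : Vector Carrier n → Set} {S : Fin m → Fin n}
    (row : Fin N → Vector Carrier n) → (∀ r → P (row r)) →
    (∀ {v} → P v → Σ (Fin N) λ r → ∀ i → row r i ≡ v i) →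
    (∀ x → ∃! _≡_ λ r → ∀ j → row r (S j) ≡ x j) → InformationSet P S
  informationSet-fromRows {P = P} {S} row row∈ toRow rows-unique = record
    { extend   = row ∘ proj₁ ∘ rows-unique
    ; extend∈  = row∈ ∘ proj₁ ∘ rows-unique
    ; extend-S = proj₁ ∘ proj₂ ∘ rows-unique
    ; unique   = unique
    }
    where
    unique : ∀ {v w} → P v → P w → v ∘ S ≗ w ∘ S → v ≗ w
    unique {v} {w} v∈ w∈ onS i = begin
      v i           ≡⟨ sym (rv≗v i) ⟩
      row rv i      ≡⟨ cong (λ r → row r i) (trans (sym (sameRow (rv≗v ∘ S)))
                                                  (sameRow (λ l → trans (rw≗w (S l)) (sym (onS l))))) ⟩
      row rw i      ≡⟨ rw≗w i ⟩
      w i           ∎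
      where
      rv = proj₁ (toRow v∈)
      rv≗v = proj₂ (toRow v∈)
      rw = proj₁ (toRow w∈)
      rw≗w = proj₂ (toRow w∈)
      sameRow : ∀ {r} → (∀ l → row r (S l) ≡ v (S l)) → proj₁ (rows-unique (v ∘ S)) ≡ r
      sameRow = proj₂ (proj₂ (rows-unique (v ∘ S)))

  dual-informationSet : ∀ {a b n} {P : Vector Carrier n → Set} {S : Fin a → Fin n} {T : Fin b → Fin n} →
    LinearlyClosed P → Partition S T → InformationSet P T → InformationSet (Dual P) S
  dual-informationSet {a} {b} {n} {P} {S} {T} closed ST infoT = record
    { extend = d ; extend∈ = d-dual ; extend-S = d-S ; unique = unique⊥ }
    where
    open Partition ST using (part; part-S; part-T; agree)
    open InformationSet infoT

    c : Fin b → Vector Carrier n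
    c j = extend (δ j)

    expand : ∀ {v} → P v → ∀ i → v i ≡ lincomb F (v ∘ T) c i
    expand {v} v∈ = unique v∈ (closed (v ∘ T) c (extend∈ ∘ δ)) λ l → sym (begin
      lincomb F (v ∘ T) c (T l)          ≡⟨ lincomb≡∑ (v ∘ T) c (T l) ⟩
      ∑[ j < b ] (v (T j) * c j (T l))   ≡⟨ sum-cong-≗ (λ j → cong (v (T j) *_) (extend-S (δ j) l)) ⟩
      ∑[ j < b ] (v (T j) * δ j l)       ≡⟨ ∑-*-δ (v ∘ T) l ⟩
      v (T l)                            ∎)

    check : Fin b → Vector Carrier a → Carrier
    check j z = ∑[ l < a ] (c j (S l) * z l)

    check-cong : ∀ j {z z′} → (∀ l → z l ≡ z′ l) → check j z ≡ check j z′
    check-cong j z≗z′ = sum-cong-≗ (λ l → cong (c j (S l) *_) (z≗z′ l))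

    c·d : ∀ d j → c j · d ≡ check j (d ∘ S) + d (T j)
    c·d d j = trans (∑-partition ST (λ i → c j i * d i)) (cong (check j (d ∘ S) +_) (begin
      ∑[ l < b ] (c j (T l) * d (T l))
        ≡⟨ sum-cong-≗ (λ l → cong (_* d (T l)) (trans (extend-S (δ j) l) (δ-comm j l))) ⟩
      ∑[ l < b ] (δ l j * d (T l))     ≡⟨ sum-cong-≗ (λ l → *-comm (δ l j) (d (T l))) ⟩
      ∑[ l < b ] (d (T l) * δ l j)     ≡⟨ ∑-*-δ (d ∘ T) j ⟩
      d (T j)                          ∎))

    T-determined : ∀ {d} → Dual P d → ∀ j → d (T j) ≡ - check j (d ∘ S)
    T-determined {d} d⊥ j = inverseʳ-unique _ _ (trans (sym (c·d d j)) (d⊥ (c j) (extend∈ (δ j))))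

    d : Vector Carrier a → Vector Carrier n
    d z = [ z , (λ j → - check j z) ] ∘ part

    d-S : ∀ z l → d z (S l) ≡ z l
    d-S z l = cong [ z , _ ] (part-S l)

    c⊥d : ∀ z j → c j · d z ≡ 0#
    c⊥d z j = begin
      c j · d z                           ≡⟨ c·d (d z) j ⟩
      check j (d z ∘ S) + d z (T j)       ≡⟨ cong₂ _+_ (check-cong j (d-S z)) (cong [ z , _ ] (part-T j)) ⟩
      check j z + - check j z             ≡⟨ -‿inverseʳ _ ⟩
      0#                                  ∎

    d-dual : ∀ z → Dual P (d z)
    d-dual z v v∈ = begin
      v · d z                                  ≡⟨ sum-cong-≗ (λ i → cong (_* d z i) (expand v∈ i)) ⟩
      lincomb F (v ∘ T) c · d z                ≡⟨ lincomb-· (v ∘ T) c (d z) ⟩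
      ∑[ j < b ] (v (T j) * (c j · d z))       ≡⟨ ∑-0 (λ j → trans (cong (v (T j) *_) (c⊥d z j)) (zeroʳ _)) ⟩
      0#                                       ∎

    unique⊥ : ∀ {v w} → Dual P v → Dual P w → v ∘ S ≗ w ∘ S → v ≗ w
    unique⊥ v⊥ w⊥ onS = agree onS λ j →
      trans (T-determined v⊥ j) (trans (cong -_ (check-cong j onS)) (sym (T-determined w⊥ j)))

  decode : ∀ {m} → Fin (q ^ m) → Vector Carrier m
  decode r = Inverse.from enum ∘ finToFun r

  encode : ∀ {m} → Vector Carrier m → Fin (q ^ m)
  encode x = funToFin (Inverse.to enum ∘ x)

  decode-encode : ∀ {m} (x : Vector Carrier m) l → decode (encode x) l ≡ x l
  decode-encode x l = trans (cong (Inverse.from enum) (finToFun-funToFin (Inverse.to enum ∘ x) l))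
                            (Inverse.strictlyInverseʳ enum (x l))

  decode-injective : ∀ {m} {r r′ : Fin (q ^ m)} → (∀ l → decode {m} r l ≡ decode r′ l) → r ≡ r′
  decode-injective {m} {r} {r′} eq = begin
    r                               ≡⟨ sym (funToFin-finToFin {m} {q} r) ⟩
    funToFin (finToFun {q} {m} r)   ≡⟨ funToFin-cong (λ l → trans (sym (Inverse.strictlyInverseˡ enum _))
                                         (trans (cong (Inverse.to enum) (eq l)) (Inverse.strictlyInverseˡ enum _))) ⟩
    funToFin (finToFun {q} {m} r′)  ≡⟨ funToFin-finToFin {m} {q} r′ ⟩
    r′                              ∎

  module Enumeration {m n} {P : Vector Carrier n → Set} {S : Fin m → Fin n}
    (closed : LinearlyClosed P) (info : InformationSet P S) where
    open InformationSet info

    row : Fin (q ^ m) → Vector Carrier n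
    row r = extend (decode r)

    basis : Fin m → Vector Carrier n
    basis j = extend (δ j)

    lincomb-basis-S : ∀ a l → lincomb F a basis (S l) ≡ a l
    lincomb-basis-S a l = trans (lincomb≡∑ a basis (S l))
      (trans (sum-cong-≗ (λ j → cong (a j *_) (extend-S (δ j) l))) (∑-*-δ a l))

    lincomb-basis∈ : ∀ a → P (lincomb F a basis)
    lincomb-basis∈ a = closed a basis (extend∈ ∘ δ)

    row-decode : ∀ r i → row r i ≡ lincomb F (decode r) basis i
    row-decode r = unique (extend∈ _) (lincomb-basis∈ _) λ l →
      trans (extend-S _ l) (sym (lincomb-basis-S _ l))

    row-encode : ∀ a i → row (encode a) i ≡ lincomb F a basis i
    row-encode a = unique (extend∈ _) (lincomb-basis∈ a) λ l →
      trans (extend-S _ l) (trans (decode-encode a l) (sym (lincomb-basis-S a l)))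

    independent : ∀ a → (∀ i → lincomb F a basis i ≡ 0#) → ∀ l → a l ≡ 0#
    independent a a·basis≡0 l = trans (sym (lincomb-basis-S a l)) (a·basis≡0 (S l))

    rows-unique : ∀ {m′} {S′ : Fin m′ → Fin n} → InformationSet P S′ →
      ∀ x → ∃! _≡_ λ r → ∀ j → row r (S′ j) ≡ x j
    rows-unique {S′ = S′} info′ x = r , row-r-S′ , λ {r′} h → decode-injective λ l → begin
      decode {m} r l    ≡⟨ sym (extend-S _ l) ⟩
      row r (S l)       ≡⟨ I′.unique (extend∈ _) (extend∈ _) (λ j → trans (row-r-S′ j) (sym (h j))) (S l) ⟩
      row r′ (S l)      ≡⟨ extend-S _ l ⟩
      decode {m} r′ l   ∎
      where
      module I′ = InformationSet info′
      v = I′.extend x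
      r = encode (v ∘ S)
      row-r≗v : ∀ i → row r i ≡ v i
      row-r≗v = unique (extend∈ _) (I′.extend∈ x) λ l → trans (extend-S _ l) (decode-encode (v ∘ S) l)
      row-r-S′ : ∀ j → row r (S′ j) ≡ x j
      row-r-S′ j = trans (row-r≗v (S′ j)) (I′.extend-S x j)

  record IsAOACode (s t k u : ℕ) (P : Vector Carrier (k +ℕ u) → Set) : Set where
    field
      closed : LinearlyClosed P
      oa     : (c : Fin t → Fin k) → Injective _≡_ _≡_ c → InformationSet P (λ j → c j ↑ˡ u)
      aoa    : (c : Fin s → Fin k) → Injective _≡_ _≡_ c → InformationSet P (withLast u c)

  aoaCode : ∀ {s t k} (X : LinearAOA F s t k) → IsAOACode s t k (t ∸ s) (Span (LinearAOA.basis X))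
  aoaCode {s} {t} {k} X = record
    { closed = span-closed basis
    ; oa     = λ c inj → fromRows (oa-rows c inj)
    ; aoa    = λ c inj → fromRows (aoa-rows c inj)
    }
    where
    open LinearAOA X
    u = t ∸ s

    row-↑ˡ : ∀ r i → row r (i ↑ˡ u) ≡ cols r i
    row-↑ˡ r = lookup-++ˡ (cols r) (lastCol r)

    row-↑ʳ : ∀ r j → row r (k ↑ʳ j) ≡ lastCol r j
    row-↑ʳ r = lookup-++ʳ (cols r) (lastCol r)

    fromRows : ∀ {m} {S : Fin m → Fin (k +ℕ u)} → (∀ x → ∃! _≡_ λ r → ∀ j → row r (S j) ≡ x j) →
      InformationSet (Span basis) S
    fromRows = informationSet-fromRows row rowsInSpan λ (a , v≗a·basis) →
      let (r , row≗a·basis) = spanInRows a in r , λ i → trans (row≗a·basis i) (sym (v≗a·basis i))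

    oa-rows : (c : Fin t → Fin k) → Injective _≡_ _≡_ c →
      ∀ x → ∃! _≡_ λ r → ∀ j → row r (c j ↑ˡ u) ≡ x j
    oa-rows c inj x = ∃!-map (λ {r} h j → trans (row-↑ˡ r (c j)) (h j))
                             (λ {r} h j → trans (sym (row-↑ˡ r (c j))) (h j))
                             (oa c inj x)

    aoa-rows : (c : Fin s → Fin k) → Injective _≡_ _≡_ c →
      ∀ x → ∃! _≡_ λ r → ∀ i → row r (withLast u c i) ≡ x i
    aoa-rows c inj x = ∃!-map to from (aoa c inj (x ∘ (_↑ˡ u)) (x ∘ (s ↑ʳ_)))
      where
      module Agree r = Equivalence (withLast-agree c (row r) (x ∘ (_↑ˡ u)) (x ∘ (s ↑ʳ_)))

      to : ∀ {r} → (∀ j → cols r (c j) ≡ x (j ↑ˡ u)) × (∀ j → lastCol r j ≡ x (s ↑ʳ j)) →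
        ∀ i → row r (withLast u c i) ≡ x i
      to {r} (onc , onLast) i = trans
        (Agree.from r ((λ j → trans (row-↑ˡ r (c j)) (onc j)) , (λ j → trans (row-↑ʳ r j) (onLast j))) i)
        (↑ˡ-++-↑ʳ s x i)

      from : ∀ {r} → (∀ i → row r (withLast u c i) ≡ x i) →
        (∀ j → cols r (c j) ≡ x (j ↑ˡ u)) × (∀ j → lastCol r j ≡ x (s ↑ʳ j))
      from {r} h with Agree.to r (λ i → trans (h i) (sym (↑ˡ-++-↑ʳ s x i)))
      ... | onc , onLast = (λ j → trans (sym (row-↑ˡ r (c j))) (onc j)) ,
                           (λ j → trans (sym (row-↑ʳ r j)) (onLast j))

  dual-aoaCode : ∀ {s t k u} {P : Vector Carrier (k +ℕ u) → Set} → s ≤ k → t ≤ k →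
    IsAOACode s t k u P → IsAOACode (k ∸ t) (k ∸ s) k u (Dual P)
  dual-aoaCode {u = u} s≤k t≤k A = record
    { closed = dual-closed
    ; oa     = λ c inj →
        let (c′ , c∣c′) = complementPartition c inj (m∸n+n≡m s≤k) in
        dual-informationSet closed (extendPartition u c∣c′) (aoa c′ (Partition.T-injective c∣c′))
    ; aoa    = λ c inj →
        let (c′ , c∣c′) = complementPartition c inj (m∸n+n≡m t≤k) in
        dual-informationSet closed (swapPartition (extendPartition u (swapPartition c∣c′)))
          (oa c′ (Partition.T-injective c∣c′))
    }
    where open IsAOACode A

  linearAOA : ∀ {s t k u} {P : Vector Carrier (k +ℕ u) → Set} → t ≤ k →
    IsAOACode s t k u P → t ∸ s ≡ u → LinearAOA F s t k
  linearAOA {s} {t} {k} t≤k A refl = record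
    { cols        = λ r i → row r (i ↑ˡ (t ∸ s))
    ; lastCol     = λ r j → row r (k ↑ʳ j)
    ; oa          = λ c inj → rows-unique (oa c inj)
    ; aoa         = λ c inj x y → ∃!-map (Equivalence.to (withLast-agree c (row _) x y))
                                         (Equivalence.from (withLast-agree c (row _) x y))
                                         (rows-unique (aoa c inj) (x ++ y))
    ; basis       = basis
    ; independent = independent
    ; rowsInSpan  = λ r → decode r , λ i → trans (↑ˡ-++-↑ʳ k (row r) i) (row-decode r i)
    ; spanInRows  = λ a → encode a , λ i → trans (↑ˡ-++-↑ʳ k (row (encode a)) i) (row-encode a i)
    }
    where
    open IsAOACode A
    open Enumeration closed (oa (λ j → inject≤ j t≤k) (inject≤-injective t≤k t≤k _ _))

theorem3p5 : (q : ℕ) → IsPrimePower q → (F : FiniteField q) →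
    (s t k : ℕ) → s ≤ t → t ≤ k →
    LinearAOA F s t k → LinearAOA F (k ∸ t) (k ∸ s) k
theorem3p5 q _ F s t k s≤t t≤k X =
  linearAOA F (m∸n≤m k s) (dual-aoaCode F (≤-trans s≤t t≤k) t≤k (aoaCode F X)) ([o∸m]∸[o∸n]≡n∸m s≤t t≤k)
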